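{- Let $n\geq 4$ and let $\mathrm{GCB}(m)$, $m\geq 2$, be the lists of involutions of $\mathcal{S}_m^B$ defined below. If $\mathrm{GCB}(n-2)$ and $\mathrm{GCB}(n-1)$ each contain every involution of $\mathcal{S}^B_{n-2}$, resp. $\mathcal{S}^B_{n-1}$, exactly once and satisfy properties A1 and A2, then $\mathrm{GCB}(n)$ contains every involution of $\mathcal{S}_n^B$ exactly once, satisfies properties A1 and A2, and is cyclic (its first element is obtained from its last element in the manner described in A2).
   Context: $\overline{i}=-i$. $\mathcal{S}_n^B$ is the group of permutations $\pi$ of $\{\pm1,\dots,\pm n\}$ with $\pi(\overline i)=\overline{\pi(i)}$, written in one-line notation $\pi(1)\cdots\pi(n)$. An involution over an alphabet $N$ of positive integers is a permutation of $\pm N$ commuting with negation and squaring to the identity, written in one-line notation with positions indexed by $N$ increasingly. Cycle notation: for positive $i\neq j$, $(i\,j)$ swaps $i\leftrightarrow j$, $\overline i\leftrightarrow\overline j$; $(\overline i\,\overline j)$ swaps $i\leftrightarrow\overline j$, $\overline i\leftrightarrow j$; $(\overline j)$ swaps $j\leftrightarrow\overline j$; $\mathrm{id}$ is the identity. List operations for $L=(w_1,\dots,w_m)$ over $N$: $\overleftarrow L$ is the reversal; for $k\notin N$, $L\cdot k$ extends each $w_\ell$ to $\pm(N\cup\{k\})$ fixing $k$, and $L\cdot\overline{k}$ extends each $w_\ell$ by composing with $(\overline k)$; for $i,j\notin N$, $L\cdot(i\,j)$ and $L\cdot(\overline i\,\overline j)$ compose each $w_\ell$ with the disjoint transposition $(i\,j)$,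 resp. $(\overline i\,\overline j)$. For a bijection $F:[r]\to N$ written $F=F(1)\cdots F(r)$ and $w$ an involution over $[r]$, $w^F$ is the involution over $N$ with $w^F(F(i))=F(w(i))$, where $F(\overline j):=\overline{F(j)}$; $L^F=(w_1^F,\dots,w_m^F)$ and $\overleftarrow{L}^F$ is its reversal. The lists: $\mathrm{GCB}(2)=(\mathrm{id},(\overline1),(\overline1)(\overline2),(\overline2),(\overline1\,\overline2),(1\,2))$; $\mathrm{GCB}(3)=(\mathrm{id},(\overline1),(\overline1)(\overline2),(\overline2),(\overline1\,\overline2),(1\,2),(1\,2)(\overline3),(\overline1\,\overline2)(\overline3),(\overline2)(\overline3),(\overline1)(\overline2)(\overline3),(\overline1)(\overline3),(\overline3),(\overline1\,\overline3),(\overline1\,\overline3)(\overline2),(1\,3)(\overline2),(1\,3),(2\,3),(\overline1)(2\,3),(\overline1)(\overline2\,\overline3),(\overline2\,\overline3))$. For $n\geq4$, $\mathrm{GCB}(n)$ is the concatenation of $\mathrm{GCB}(n-1)\cdot n$, then $\overleftarrow{\mathrm{GCB}}(n-1)\cdot\overline n$, then for $i=1,\dots,n-1$ in order, with $F_i=1\,2\cdots(i-1)\,(i+1)\cdots(n-1)$ (the increasing bijection $[n-2]\to[n-1]\setminus\{i\}$): if $i$ is odd, $\mathrm{GCB}(n-2)^{F_i}\cdot(\overline i\,\overline n)$ followed by $\overleftarrow{\mathrm{GCB}}(n-2)^{F_i}\cdot(i\,n)$; if $i$ is even, $\mathrm{GCB}(n-2)^{F_i}\cdot(i\,n)$ followed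 by $\overleftarrow{\mathrm{GCB}}(n-2)^{F_i}\cdot(\overline i\,\overline n)$. Property A1 (for a list of involutions over $[n]$): the first element is $\mathrm{id}$ and the last is $(n-1\;n)$ or $(\overline{n-1}\;\overline n)$. Property A2: each element is obtained from its predecessor, in one-line notation, by one of: (i) exchanging the entries in two positions, or (ii) cyclically rotating the entries in three positions, in either case possibly also changing the signs of at most two entries; or (iii) changing the signs of one or two entries. -}

module Defs where

open import Data.Bool using (Bool; true; false; if_then_else_; _∨_)
open import Data.Nat using (ℕ; zero; suc; _∸_; _≤_; _<_; _≡ᵇ_; _<ᵇ_)
open import Data.Integer using (ℤ; +_; -[1+_]; -_; ∣_∣) renaming (_≟_ to _≟ℤ_)
open import Data.List using (List; []; _∷_; _++_; map; reverse; concatMap; applyUpTo; upTo; length; head; last; foldr)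
open import Data.List.Relation.Unary.All using (All)
open import Data.List.Relation.Unary.Unique.Propositional using (Unique)
open import Data.List.Relation.Unary.Linked using (Linked)
open import Data.List.Membership.Propositional using (_∈_)
open import Data.Maybe using (just)
open import Data.Product using (Σ; _×_)
open import Data.Sum using (_⊎_)
open import Data.Unit using (⊤)
open import Function using (_∘_; id)
open import Relation.Nullary using (¬_; does)
open import Relation.Binary.PropositionalEquality using (_≡_; _≢_)

-- An element of S_n^B is written as the list  π(1) ⋯ π(n)  of integers.
-- A "signed map" is a function ℤ → ℤ (we only ever care about its
-- values on ±[n]).

Word : Set
Word = List ℤ

_==ℤ_ : ℤ → ℤ → Bool
a ==ℤ b = does (a ≟ℤ b)

-- entry at 0-based position k (0 if out of range)
at : Word → ℕ → ℤ
at []       k       = + 0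
at (x ∷ w)  zero    = x
at (x ∷ w)  (suc k) = at w k

-- the signed permutation of ±[n] given by a one-line word:
-- apply w j = π(j), apply w (-j) = -π(j)
apply : Word → ℤ → ℤ
apply w (+ zero)  = + zero
apply w (+ suc k) = at w k
apply w -[1+ k ]  = - at w k

oneLine : ℕ → (ℤ → ℤ) → Word
oneLine n f = map (λ k → f (+ suc k)) (upTo n)

-- w is an involution of S_n^B: a word of length n with entries in ±[n]
-- such that π(π(j)) = j for j ∈ [n] (hence also for j ∈ -[n], and π is
-- a bijection of ±[n] commuting with negation).
IsInvolution : ℕ → Word → Set
IsInvolution n w =
  (length w ≡ n) ×
  (∀ k → k < n →
     (1 ≤ ∣ at w k ∣) × (∣ at w k ∣ ≤ n) ×
     (apply w (apply w (+ suc k)) ≡ + suc k))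

tr : ℕ → ℕ → ℤ → ℤ
tr i j x =
  if x ==ℤ (+ i) then + j else
  if x ==ℤ (- (+ i)) then - (+ j) else
  if x ==ℤ (+ j) then + i else
  if x ==ℤ (- (+ j)) then - (+ i) else x

-- (ī j̄) : i ↔ j̄, ī ↔ j
trBar : ℕ → ℕ → ℤ → ℤ
trBar i j x =
  if x ==ℤ (+ i) then - (+ j) else
  if x ==ℤ (- (+ i)) then + j else
  if x ==ℤ (+ j) then - (+ i) else
  if x ==ℤ (- (+ j)) then + i else x

neg : ℕ → ℤ → ℤ
neg j x = if ∣ x ∣ ≡ᵇ j then - x else x

cyc : ℕ → List (ℤ → ℤ) → Word
cyc n cs = oneLine n (foldr (λ f g → f ∘ g) (λ x → x) cs)

fixing : List ℕ → (ℤ → ℤ) → ℤ → ℤ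
fixing []       f x = f x
fixing (k ∷ ks) f x = if ∣ x ∣ ≡ᵇ k then x else fixing ks f x

dotFix : ℕ → Word → Word
dotFix n w = oneLine n (fixing (n ∷ []) (apply w))

dotNeg : ℕ → Word → Word
dotNeg n w = oneLine n (neg n ∘ fixing (n ∷ []) (apply w))

-- F_i = 1 2 ⋯ (i-1) (i+1) ⋯ : increasing bijection [m] → [m+1] ∖ {i},
-- extended by F(j̄) = \overline{F(j)}; and its inverse on ±([m+1]∖{i}).
Fn : ℕ → ℕ → ℕ
Fn i k = if k <ᵇ i then k else suc k

Finvn : ℕ → ℕ → ℕ
Finvn i k = if k <ᵇ i then k else k ∸ 1

oddExt : (ℕ → ℕ) → ℤ → ℤ
oddExt f (+ k)     = + f k
oddExt f -[1+ k ]  = - (+ f (suc k))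

-- w^{F_i} as a signed map on ±([m+1] ∖ {i}) :  x ↦ F(w(F⁻¹(x)))
conj : ℕ → Word → ℤ → ℤ
conj i w = oddExt (Fn i) ∘ apply w ∘ oddExt (Finvn i)

dotTr : ℕ → ℕ → Word → Word
dotTr n i w = oneLine n (tr i n ∘ fixing (i ∷ n ∷ []) (conj i w))

dotTrBar : ℕ → ℕ → Word → Word
dotTrBar n i w = oneLine n (trBar i n ∘ fixing (i ∷ n ∷ []) (conj i w))

odd : ℕ → Bool
odd zero          = false
odd (suc zero)    = true
odd (suc (suc k)) = odd k

GCB2 : List Word
GCB2 =
  cyc 2 [] ∷
  cyc 2 (neg 1 ∷ []) ∷
  cyc 2 (neg 1 ∷ neg 2 ∷ []) ∷
  cyc 2 (neg 2 ∷ []) ∷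
  cyc 2 (trBar 1 2 ∷ []) ∷
  cyc 2 (tr 1 2 ∷ []) ∷ []

GCB3 : List Word
GCB3 =
  cyc 3 [] ∷
  cyc 3 (neg 1 ∷ []) ∷
  cyc 3 (neg 1 ∷ neg 2 ∷ []) ∷
  cyc 3 (neg 2 ∷ []) ∷
  cyc 3 (trBar 1 2 ∷ []) ∷
  cyc 3 (tr 1 2 ∷ []) ∷
  cyc 3 (tr 1 2 ∷ neg 3 ∷ []) ∷
  cyc 3 (trBar 1 2 ∷ neg 3 ∷ []) ∷
  cyc 3 (neg 2 ∷ neg 3 ∷ []) ∷
  cyc 3 (neg 1 ∷ neg 2 ∷ neg 3 ∷ []) ∷
  cyc 3 (neg 1 ∷ neg 3 ∷ []) ∷
  cyc 3 (neg 3 ∷ []) ∷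
  cyc 3 (trBar 1 3 ∷ []) ∷
  cyc 3 (trBar 1 3 ∷ neg 2 ∷ []) ∷
  cyc 3 (tr 1 3 ∷ neg 2 ∷ []) ∷
  cyc 3 (tr 1 3 ∷ []) ∷
  cyc 3 (tr 2 3 ∷ []) ∷
  cyc 3 (neg 1 ∷ tr 2 3 ∷ []) ∷
  cyc 3 (neg 1 ∷ trBar 2 3 ∷ []) ∷
  cyc 3 (trBar 2 3 ∷ []) ∷ []

block : ℕ → List Word → ℕ → List Word
block n L i =
  if odd i
  then map (dotTrBar n i) L ++ map (dotTr n i) (reverse L)
  else map (dotTr n i) L ++ map (dotTrBar n i) (reverse L)

-- GCB(n) (only meaningful for n ≥ 2; GCB(0) = GCB(1) = [] by convention)
GCB : ℕ → List Word
GCB zero = []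
GCB (suc zero) = []
GCB (suc (suc zero)) = GCB2
GCB (suc (suc (suc zero))) = GCB3
GCB (suc (suc (suc (suc k)))) =
  map (dotFix n) (GCB (suc (suc (suc k)))) ++
  map (dotNeg n) (reverse (GCB (suc (suc (suc k))))) ++
  concatMap (block n (GCB (suc (suc k)))) (applyUpTo suc (suc (suc (suc k))))
  where
  n : ℕ
  n = suc (suc (suc (suc k)))

ExactlyOnce : ℕ → List Word → Set
ExactlyOnce n L =
  All (IsInvolution n) L × Unique L × (∀ w → IsInvolution n w → w ∈ L)

A1 : ℕ → List Word → Set
A1 n L =
  (head L ≡ just (cyc n [])) ×
  ((last L ≡ just (cyc n (tr (n ∸ 1) n ∷ []))) ⊎
   (last L ≡ just (cyc n (trBar (n ∸ 1) n ∷ []))))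

-- position rearrangements allowed in A2 (0-based positions)
data Shape : Set where
  none : Shape
  swap : ℕ → ℕ → Shape
  rot  : ℕ → ℕ → ℕ → Shape

ValidShape : ℕ → Shape → Set
ValidShape n none = ⊤
ValidShape n (swap a b) = (a < n) × (b < n) × (a ≢ b)
ValidShape n (rot a b c) =
  (a < n) × (b < n) × (c < n) × (a ≢ b) × (b ≢ c) × (a ≢ c)

-- new position p takes the entry of old position (source s p)
source : Shape → ℕ → ℕ
source none p = p
source (swap a b) p = if p ≡ᵇ a then b else if p ≡ᵇ b then a else p
source (rot a b c) p =
  if p ≡ᵇ a then b else if p ≡ᵇ b then c else if p ≡ᵇ c then a else p

memℕ : ℕ → List ℕ → Bool
memℕ k [] = false
memℕ k (x ∷ xs) = (k ≡ᵇ x) ∨ memℕ k xs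

signAt : List ℕ → ℕ → ℤ → ℤ
signAt S p x = if memℕ p S then - x else x

Step : ℕ → Word → Word → Set
Step n u v =
  (length u ≡ n) × (length v ≡ n) ×
  Σ Shape λ s → ValidShape n s ×
  Σ (List ℕ) λ S → (length S ≤ 2) × All (_< n) S ×
    ((s ≡ none) → ¬ (S ≡ [])) ×
    (∀ p → p < n → at v p ≡ signAt S p (at u (source s p)))

A2 : ℕ → List Word → Set
A2 n L = Linked (Step n) L

Cyclic : ℕ → List Word → Set
Cyclic n L = Σ Word λ a → Σ Word λ z →
  (head L ≡ just a) × (last L ≡ just z) × Step n z a

-- Every piece of GCB(n) is the image of GCB(n-1) or GCB(n-2) under one of the maps w ↦ w · n,
-- w · n̄, w^{F_i} · (i n), w^{F_i} · (ī n̄). Each such map keeps w, relabelled, on the old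
-- positions and puts a fixed, possibly signed, transposition on the one or two new positions;
-- hence it is injective on involutions, sends A2-steps to A2-steps, and its image is exactly the
-- set of involutions with those new entries. The new entries of an involution π of S_n^B are
-- determined by π(n), so π lies in exactly one piece. The junction between the two halves of a
-- pair of pieces only changes the signs of the new entries; all other junctions, including the
-- one closing the cycle, join images of the identity, which differ by a transposition or a
-- 3-cycle of positions with some sign changes.

module Submission where

open import Defs
open import Data.Bool using (Bool; true; false; if_then_else_; _∨_; not)
open import Data.Bool.Properties using (if-cong; ∨-zeroʳ; ¬-not) renaming (_≟_ to _≟𝔹_)
open import Data.Nat using (ℕ; zero; suc; _∸_; _≤_; _<_; _≡ᵇ_; _<ᵇ_; z≤n; s≤s)
open import Data.Nat.Properties
open import Data.Integer using (ℤ; +_; -[1+_]; -_; ∣_∣) renaming (_≟_ to _≟ℤ_)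
open import Data.Integer.Properties using (neg-involutive; ∣-i∣≡∣i∣)
open import Data.List using (List; []; _∷_; _++_; map; reverse; concatMap; applyUpTo; length; head; last)
open import Data.List.Properties using (length-map; ++-identityʳ; ++-assoc; unfold-reverse; reverse-involutive; head-map; last-map)
open import Data.List.Membership.Propositional.Properties using (∈-map⁺; ∈-map⁻; ∈-++⁺ˡ; ∈-++⁺ʳ; ∈-concatMap⁺; ∈-applyUpTo⁺; ∈-applyUpTo⁻)
open import Data.List.Relation.Binary.Permutation.Propositional using (↭⇒↭ₛ; ↭-sym)
open import Data.List.Relation.Binary.Permutation.Propositional.Properties using (↭-reverse; All-resp-↭)
open import Data.List.Relation.Binary.Permutation.Setoid.Properties using (Unique-resp-↭)
import Data.List.Relation.Unary.Linked.Properties as Linked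
open import Data.List.Relation.Unary.All using (All; []; _∷_) renaming (lookup to All-lookup; map to All-map; tabulate to All-tabulate)
open import Data.List.Relation.Unary.All.Properties using (++⁺; concat⁺) renaming (map⁺ to All-map⁺)
open import Data.List.Relation.Unary.Any using (here; there)
import Data.List.Relation.Unary.Any.Properties as Any
open import Data.List.Relation.Unary.Unique.Propositional using (Unique)
import Data.List.Relation.Unary.Unique.Propositional.Properties as Unique
open import Data.List.Relation.Unary.AllPairs using ([]; _∷_)
open import Data.List.Relation.Unary.Linked using (Linked; []; [-]; _∷_)
open import Data.List.Membership.Propositional using (_∈_; lose)
open import Data.Maybe as Maybe using (just)
open import Data.Maybe.Relation.Binary.Connected using (Connected; just)
open import Data.Product using (Σ; _×_; _,_; proj₁; proj₂)
open import Data.Sum using (_⊎_; inj₁; inj₂)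
open import Data.Unit using (tt)
open import Data.Empty using (⊥; ⊥-elim)
open import Function using (_∘_; id)
open import Relation.Nullary using (Dec; yes; no)
open import Relation.Nullary.Decidable using (dec-true; dec-false)
open import Relation.Binary.Definitions using (tri<; tri≈; tri>)
open import Relation.Binary.PropositionalEquality using (_≡_; _≢_; refl; sym; trans; cong; cong₂; subst; subst₂; ≢-sym; module ≡-Reasoning)
import Relation.Binary.PropositionalEquality as ≡

≡ᵇ-refl : ∀ n → (n ≡ᵇ n) ≡ true
≡ᵇ-refl n = dec-true (n ≟ n) refl

≡ᵇ-false : ∀ {m n} → m ≢ n → (m ≡ᵇ n) ≡ false
≡ᵇ-false {m} {n} = dec-false (m ≟ n)

<ᵇ-true : ∀ {m n} → m < n → (m <ᵇ n) ≡ true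
<ᵇ-true {m} {n} = dec-true (m <? n)

<ᵇ-false : ∀ {m n} → n ≤ m → (m <ᵇ n) ≡ false
<ᵇ-false {m} {n} n≤m = dec-false (m <? n) (≤⇒≯ n≤m)

==ℤ-refl : ∀ x → (x ==ℤ x) ≡ true
==ℤ-refl x = dec-true (x ≟ℤ x) refl

==ℤ-false : ∀ {x y} → x ≢ y → (x ==ℤ y) ≡ false
==ℤ-false {x} {y} = dec-false (x ≟ℤ y)

≡ᵇ-cong-injective : ∀ (f : ℕ → ℕ) → (∀ {x y} → f x ≡ f y → x ≡ y) → ∀ a b → (f a ≡ᵇ f b) ≡ (a ≡ᵇ b)
≡ᵇ-cong-injective f f-inj a b with a ≟ b
... | yes refl = trans (≡ᵇ-refl (f a)) (sym (≡ᵇ-refl a))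
... | no a≢b = trans (≡ᵇ-false (a≢b ∘ f-inj)) (sym (≡ᵇ-false a≢b))

not-odd-suc : ∀ j → not (odd (suc j)) ≡ odd j
not-odd-suc zero = refl
not-odd-suc (suc zero) = refl
not-odd-suc (suc (suc j)) = not-odd-suc j

if-branches : ∀ {A : Set} (f : Bool → A) b → (if b then f true else f false) ≡ f b
if-branches f true = refl
if-branches f false = refl

module _ {A : Set} where

  All-reverse : ∀ {P : A → Set} {xs} → All P xs → All P (reverse xs)
  All-reverse {xs = xs} = All-resp-↭ (↭-sym (↭-reverse xs))

  Unique-reverse : ∀ {xs : List A} → Unique xs → Unique (reverse xs)
  Unique-reverse {xs} = Unique-resp-↭ (≡.setoid A) (↭⇒↭ₛ (↭-sym (↭-reverse xs)))

  Unique-map : ∀ {B : Set} {P : A → Set} (f : A → B) → (∀ {x y} → P x → P y → f x ≡ f y → x ≡ y) →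
               ∀ {xs} → All P xs → Unique xs → Unique (map f xs)
  Unique-map f f-inj [] [] = []
  Unique-map f f-inj {x ∷ xs} (px ∷ pxs) (x∉xs ∷ u) =
    All-tabulate fresh ∷ Unique-map f f-inj pxs u
    where
    fresh : ∀ {z} → z ∈ map f xs → f x ≢ z
    fresh z∈ fx≡z with ∈-map⁻ f z∈
    ... | y , y∈xs , refl = All-lookup x∉xs y∈xs (f-inj px (All-lookup pxs y∈xs) fx≡z)

  head-++ : ∀ {xs ys : List A} {x} → head xs ≡ just x → head (xs ++ ys) ≡ just x
  head-++ {x ∷ xs} hd = hd

  last-++ : ∀ {xs ys : List A} {y} → last ys ≡ just y → last (xs ++ ys) ≡ just y
  last-++ {[]} lt = lt
  last-++ {x ∷ []} {y ∷ ys} lt = lt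
  last-++ {x ∷ x′ ∷ xs} {ys} lt = last-++ {x′ ∷ xs} {ys} lt

  last-reverse : ∀ (xs : List A) → last (reverse xs) ≡ head xs
  last-reverse [] = refl
  last-reverse (x ∷ xs) = trans (cong last (unfold-reverse x xs)) (last-++ {reverse xs} {x ∷ []} refl)

  head-reverse : ∀ (xs : List A) → head (reverse xs) ≡ last xs
  head-reverse xs = trans (sym (last-reverse (reverse xs))) (cong last (reverse-involutive xs))

  head∈ : ∀ {xs : List A} {x} → head xs ≡ just x → x ∈ xs
  head∈ {x ∷ xs} refl = here refl

  last-exists : ∀ {xs : List A} {x} → head xs ≡ just x → Σ A λ z → (last xs ≡ just z) × (z ∈ xs)
  last-exists {x ∷ []} refl = x , refl , here refl
  last-exists {x ∷ y ∷ xs} refl with last-exists {y ∷ xs} refl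
  ... | z , lt , z∈ = z , lt , there z∈

  linked-++ : ∀ {R : A → A → Set} {xs ys x y} → last xs ≡ just x → head ys ≡ just y → R x y →
              Linked R xs → Linked R ys → Linked R (xs ++ ys)
  linked-++ {R} lt hd r Rxs Rys = Linked.++⁺ Rxs (subst₂ (Connected R) (sym lt) (sym hd) (just r)) Rys

  linked-reverse : ∀ {R : A → A → Set} → (∀ {x y} → R x y → R y x) → ∀ {xs} → Linked R xs → Linked R (reverse xs)
  linked-reverse sym-R {[]} l = l
  linked-reverse sym-R {x ∷ []} l = l
  linked-reverse {R} sym-R {x ∷ y ∷ xs} (r ∷ l) = subst (Linked R) (sym (unfold-reverse x (y ∷ xs)))
    (linked-++ {xs = reverse (y ∷ xs)} (last-reverse (y ∷ xs)) refl (sym-R r) (linked-reverse sym-R l) [-])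

  linked-map : ∀ {B : Set} {R : A → A → Set} {R′ : B → B → Set} {P : A → Set} (f : A → B) →
               (∀ {x y} → P x → P y → R x y → R′ (f x) (f y)) →
               ∀ {xs} → All P xs → Linked R xs → Linked R′ (map f xs)
  linked-map f h [] [] = []
  linked-map f h (px ∷ []) [-] = [-]
  linked-map f h (px ∷ py ∷ ps) (r ∷ l) = h px py r ∷ linked-map f h (py ∷ ps) l

  map≡[] : ∀ {B : Set} (f : A → B) {xs} → map f xs ≡ [] → xs ≡ []
  map≡[] f {[]} _ = refl

  length-map-≤ : ∀ {B : Set} (f : A → B) (xs : List A) {k} → length xs ≤ k → length (map f xs) ≤ k
  length-map-≤ f xs = subst (_≤ _) (sym (length-map f xs))

  head-map-just : ∀ {B : Set} (f : A → B) {xs x} → head xs ≡ just x → head (map f xs) ≡ just (f x)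
  head-map-just f {xs} hd = trans (head-map xs) (cong (Maybe.map f) hd)

  last-map-just : ∀ {B : Set} (f : A → B) {xs x} → last xs ≡ just x → last (map f xs) ≡ just (f x)
  last-map-just f {xs} lt = trans (last-map f xs) (cong (Maybe.map f) lt)

module _ {A : Set} (G : ℕ → List A) where

  ∈-concatMap : ∀ {i is w} → i ∈ is → w ∈ G i → w ∈ concatMap G is
  ∈-concatMap i∈ w∈ = ∈-concatMap⁺ G (lose i∈ w∈)

  All-concatMap : ∀ {P : A → Set} {is} → (∀ {i} → i ∈ is → All P (G i)) → All P (concatMap G is)
  All-concatMap all-G = concat⁺ (All-map⁺ (All-tabulate all-G))

  module Keyed (κ : A → ℕ) where

    κ∈ : ∀ {is} → (∀ {i} → i ∈ is → All (λ w → κ w ≡ i) (G i)) → All (λ w → κ w ∈ is) (concatMap G is)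
    κ∈ keyed = All-concatMap (λ i∈ → All-map (λ κw≡i → subst (_∈ _) (sym κw≡i) i∈) (keyed i∈))

    Unique-concatMap : ∀ {is} → Unique is → (∀ {i} → i ∈ is → Unique (G i)) →
                       (∀ {i} → i ∈ is → All (λ w → κ w ≡ i) (G i)) → Unique (concatMap G is)
    Unique-concatMap {[]} _ _ _ = []
    Unique-concatMap {i ∷ is} (i∉is ∷ u) unique-G keyed =
      Unique.++⁺ (unique-G (here refl)) (Unique-concatMap u (unique-G ∘ there) (keyed ∘ there))
        (λ (w∈Gi , w∈rest) → All-lookup i∉is (subst (_∈ is) (All-lookup (keyed (here refl)) w∈Gi)
                                                 (All-lookup (κ∈ (keyed ∘ there)) w∈rest)) refl)

  head-concatMap-applyUpTo : ∀ f k {x} → head (G (f 0)) ≡ just x → head (concatMap G (applyUpTo f (suc k))) ≡ just x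
  head-concatMap-applyUpTo f k hd = head-++ {xs = G (f 0)} hd

  last-concatMap-applyUpTo : ∀ f k {x} → last (G (f k)) ≡ just x → last (concatMap G (applyUpTo f (suc k))) ≡ just x
  last-concatMap-applyUpTo f zero lt = trans (cong last (++-identityʳ (G (f 0)))) lt
  last-concatMap-applyUpTo f (suc k) lt = last-++ {xs = G (f 0)} (last-concatMap-applyUpTo (f ∘ suc) k lt)

  linked-concatMap-applyUpTo : ∀ {R : A → A → Set} f k → (∀ {j} → j < k → Linked R (G (f j))) →
    (∀ {j} → suc j < k → Σ A λ x → Σ A λ y → (last (G (f j)) ≡ just x) × (head (G (f (suc j))) ≡ just y) × R x y) →
    Linked R (concatMap G (applyUpTo f k))
  linked-concatMap-applyUpTo f zero _ _ = []
  linked-concatMap-applyUpTo {R} f (suc zero) linked-G _ = subst (Linked R) (sym (++-identityʳ (G (f 0)))) (linked-G (s≤s z≤n))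
  linked-concatMap-applyUpTo f (suc (suc k)) linked-G junction =
    let (_ , _ , lt , hd , r) = junction (s≤s (s≤s z≤n)) in
    linked-++ {xs = G (f 0)} lt (head-concatMap-applyUpTo (f ∘ suc) k hd) r (linked-G (s≤s z≤n))
      (linked-concatMap-applyUpTo (f ∘ suc) (suc k) (linked-G ∘ s≤s) (junction ∘ s≤s))

at-map-applyUpTo : ∀ (g : ℕ → ℤ) (f : ℕ → ℕ) n {p} → p < n → at (map g (applyUpTo f n)) p ≡ g (f p)
at-map-applyUpTo g f (suc n) {zero} _ = refl
at-map-applyUpTo g f (suc n) {suc p} (s≤s p<n) = at-map-applyUpTo g (f ∘ suc) n p<n

length-map-applyUpTo : ∀ (g : ℕ → ℤ) (f : ℕ → ℕ) n → length (map g (applyUpTo f n)) ≡ n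
length-map-applyUpTo g f zero = refl
length-map-applyUpTo g f (suc n) = cong suc (length-map-applyUpTo g (f ∘ suc) n)

at-oneLine : ∀ n f {p} → p < n → at (oneLine n f) p ≡ f (+ suc p)
at-oneLine n f = at-map-applyUpTo (λ k → f (+ suc k)) id n

length-oneLine : ∀ n f → length (oneLine n f) ≡ n
length-oneLine n f = length-map-applyUpTo (λ k → f (+ suc k)) id n

word-ext : ∀ {n} (u v : Word) → length u ≡ n → length v ≡ n → (∀ p → p < n → at u p ≡ at v p) → u ≡ v
word-ext [] [] _ _ _ = refl
word-ext [] (_ ∷ _) refl ()
word-ext (_ ∷ _) [] refl ()
word-ext {suc n} (x ∷ u) (y ∷ v) refl lv h =
  cong₂ _∷_ (h zero (s≤s z≤n)) (word-ext u v refl (suc-injective lv) (λ p p<n → h (suc p) (s≤s p<n)))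

at-id : ∀ n {p} → p < n → at (cyc n []) p ≡ + suc p
at-id n = at-oneLine n id

InvolutiveAt : ℕ → Word → ℕ → Set
InvolutiveAt n w k = (1 ≤ ∣ at w k ∣) × (∣ at w k ∣ ≤ n) × (apply w (apply w (+ suc k)) ≡ + suc k)

involutiveAt : ∀ {n} w {a x} → at w a ≡ x → 1 ≤ ∣ x ∣ → ∣ x ∣ ≤ n → apply w x ≡ + suc a → InvolutiveAt n w a
involutiveAt w refl 1≤x x≤n wx≡a = 1≤x , x≤n , wx≡a

sign : Bool → ℤ → ℤ
sign false x = x
sign true x = - x

∣sign∣ : ∀ b x → ∣ sign b x ∣ ≡ ∣ x ∣
∣sign∣ false x = refl
∣sign∣ true x = ∣-i∣≡∣i∣ x

sign-involutive : ∀ b x → sign b (sign b x) ≡ x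
sign-involutive false x = refl
sign-involutive true x = neg-involutive x

apply-sign : ∀ b w k → apply w (sign b (+ suc k)) ≡ sign b (at w k)
apply-sign false w k = refl
apply-sign true w k = refl

signed-form : ∀ t → 1 ≤ ∣ t ∣ → Σ Bool λ c → Σ ℕ λ r → t ≡ sign c (+ suc r)
signed-form (+ suc r) _ = false , r , refl
signed-form -[1+ r ] _ = true , r , refl

sign-not : ∀ b x → sign (not b) x ≡ - sign b x
sign-not false x = refl
sign-not true x = sym (neg-involutive x)

sign-not-≢ : ∀ b k → sign b (+ suc k) ≢ sign (not b) (+ suc k)
sign-not-≢ false k ()
sign-not-≢ true k ()

source-swap₁ : ∀ a b → source (swap a b) a ≡ b
source-swap₁ a b = if-cong (≡ᵇ-refl a)

source-swap₂ : ∀ {a b} → b ≢ a → source (swap a b) b ≡ a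
source-swap₂ {a} {b} b≢a = trans (if-cong (≡ᵇ-false b≢a)) (if-cong (≡ᵇ-refl b))

source-swap-other : ∀ {a b p} → p ≢ a → p ≢ b → source (swap a b) p ≡ p
source-swap-other p≢a p≢b = trans (if-cong (≡ᵇ-false p≢a)) (if-cong (≡ᵇ-false p≢b))

source-rot₁ : ∀ a b c → source (rot a b c) a ≡ b
source-rot₁ a b c = if-cong (≡ᵇ-refl a)

source-rot₂ : ∀ {a b c} → b ≢ a → source (rot a b c) b ≡ c
source-rot₂ {a} {b} b≢a = trans (if-cong (≡ᵇ-false b≢a)) (if-cong (≡ᵇ-refl b))

source-rot₃ : ∀ {a b c} → c ≢ a → c ≢ b → source (rot a b c) c ≡ a
source-rot₃ {a} {b} {c} c≢a c≢b =
  trans (if-cong (≡ᵇ-false c≢a)) (trans (if-cong (≡ᵇ-false c≢b)) (if-cong (≡ᵇ-refl c)))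

source-rot-other : ∀ {a b c p} → p ≢ a → p ≢ b → p ≢ c → source (rot a b c) p ≡ p
source-rot-other p≢a p≢b p≢c =
  trans (if-cong (≡ᵇ-false p≢a)) (trans (if-cong (≡ᵇ-false p≢b)) (if-cong (≡ᵇ-false p≢c)))

inverse : Shape → Shape
inverse none = none
inverse (swap a b) = swap a b
inverse (rot a b c) = rot a c b

inverse-involutive : ∀ s → inverse (inverse s) ≡ s
inverse-involutive none = refl
inverse-involutive (swap a b) = refl
inverse-involutive (rot a b c) = refl

inverse-valid : ∀ {n} s → ValidShape n s → ValidShape n (inverse s)
inverse-valid none v = tt
inverse-valid (swap a b) v = v
inverse-valid (rot a b c) (a< , b< , c< , a≢b , b≢c , a≢c) = a< , c< , b< , a≢c , ≢-sym b≢c , a≢b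

source-inverseʳ : ∀ {n} s → ValidShape n s → ∀ q → source s (source (inverse s) q) ≡ q
source-inverseʳ none v q = refl
source-inverseʳ (swap a b) (_ , _ , a≢b) q with q ≟ a | q ≟ b
... | yes refl | _ = trans (cong (source (swap q b)) (source-swap₁ q b)) (source-swap₂ (≢-sym a≢b))
... | no q≢a | yes refl = trans (cong (source (swap a q)) (source-swap₂ (≢-sym a≢b))) (source-swap₁ a q)
... | no q≢a | no q≢b = trans (cong (source (swap a b)) (source-swap-other q≢a q≢b)) (source-swap-other q≢a q≢b)
source-inverseʳ (rot a b c) (_ , _ , _ , a≢b , b≢c , a≢c) q with q ≟ a | q ≟ b | q ≟ c
... | yes refl | _ | _ =
  trans (cong (source (rot q b c)) (source-rot₁ q c b)) (source-rot₃ (≢-sym a≢c) (≢-sym b≢c))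
... | no q≢a | yes refl | _ = trans (cong (source (rot a q c)) (source-rot₃ (≢-sym a≢b) b≢c)) (source-rot₁ a q c)
... | no q≢a | no q≢b | yes refl =
  trans (cong (source (rot a b q)) (source-rot₂ (≢-sym a≢c))) (source-rot₂ (≢-sym a≢b))
... | no q≢a | no q≢b | no q≢c =
  trans (cong (source (rot a b c)) (source-rot-other q≢a q≢c q≢b)) (source-rot-other q≢a q≢b q≢c)

source-inverseˡ : ∀ {n} s → ValidShape n s → ∀ q → source (inverse s) (source s q) ≡ q
source-inverseˡ s v q = subst (λ t → source (inverse s) (source t q) ≡ q) (inverse-involutive s)
  (source-inverseʳ (inverse s) (inverse-valid s v) q)

source-injective : ∀ {n} s → ValidShape n s → ∀ {x y} → source s x ≡ source s y → x ≡ y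
source-injective s v {x} {y} e =
  trans (sym (source-inverseˡ s v x)) (trans (cong (source (inverse s)) e) (source-inverseˡ s v y))

source-< : ∀ {n} s → ValidShape n s → ∀ {q} → q < n → source s q < n
source-< none v q<n = q<n
source-< (swap a b) (a< , b< , a≢b) {q} q<n with q ≟ a | q ≟ b
... | yes refl | _ = subst (_< _) (sym (source-swap₁ q b)) b<
... | no q≢a | yes refl = subst (_< _) (sym (source-swap₂ (≢-sym a≢b))) a<
... | no q≢a | no q≢b = subst (_< _) (sym (source-swap-other q≢a q≢b)) q<n
source-< (rot a b c) (a< , b< , c< , a≢b , b≢c , a≢c) {q} q<n with q ≟ a | q ≟ b | q ≟ c
... | yes refl | _ | _ = subst (_< _) (sym (source-rot₁ q b c)) b<
... | no q≢a | yes refl | _ = subst (_< _) (sym (source-rot₂ (≢-sym a≢b))) c<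
... | no q≢a | no q≢b | yes refl = subst (_< _) (sym (source-rot₃ (≢-sym a≢c) (≢-sym b≢c))) a<
... | no q≢a | no q≢b | no q≢c = subst (_< _) (sym (source-rot-other q≢a q≢b q≢c)) q<n

memℕ-map : ∀ (f : ℕ → ℕ) → (∀ {x y} → f x ≡ f y → x ≡ y) → ∀ a S → memℕ (f a) (map f S) ≡ memℕ a S
memℕ-map f f-inj a [] = refl
memℕ-map f f-inj a (x ∷ S) = cong₂ _∨_ (≡ᵇ-cong-injective f f-inj a x) (memℕ-map f f-inj a S)

signAt-involutive : ∀ S p x → signAt S p (signAt S p x) ≡ x
signAt-involutive S p x with memℕ p S
... | true = neg-involutive x
... | false = refl

memℕ-true : ∀ {p S} → p ∈ S → memℕ p S ≡ true
memℕ-true {p} {.p ∷ S} (here refl) = cong (_∨ memℕ p S) (≡ᵇ-refl p)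
memℕ-true {p} {x ∷ S} (there p∈S) = trans (cong ((p ≡ᵇ x) ∨_) (memℕ-true p∈S)) (∨-zeroʳ _)

memℕ-false : ∀ {p S} → All (p ≢_) S → memℕ p S ≡ false
memℕ-false [] = refl
memℕ-false (p≢x ∷ p∉S) = cong₂ _∨_ (≡ᵇ-false p≢x) (memℕ-false p∉S)

Step-sym : ∀ {n u v} → Step n u v → Step n v u
Step-sym {n} {u} {v} (lu , lv , s , vs , S , lS , S<n , moves , pt) =
  lv , lu , inverse s , inverse-valid s vs , map (source s) S , length-map-≤ (source s) S lS ,
  All-map⁺ (All-map (source-< s vs) S<n) , (λ e eS → moves (inverse-none s e) (map≡[] (source s) eS)) , pt⁻¹
  where
  inverse-none : ∀ s → inverse s ≡ none → s ≡ none
  inverse-none none _ = refl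
  pt⁻¹ : ∀ q → q < n → at u q ≡ signAt (map (source s) S) q (at v (source (inverse s) q))
  pt⁻¹ q q<n = sym (begin
    signAt (map (source s) S) q (at v r)        ≡⟨ cong (λ t → signAt (map (source s) S) t (at v r)) (sym sr≡q) ⟩
    signAt (map (source s) S) (source s r) (at v r)
      ≡⟨ cong (λ b → if b then - at v r else at v r) (memℕ-map (source s) (source-injective s vs) r S) ⟩
    signAt S r (at v r)                          ≡⟨ cong (signAt S r) (pt r (source-< (inverse s) (inverse-valid s vs) q<n)) ⟩
    signAt S r (signAt S r (at u (source s r)))  ≡⟨ signAt-involutive S r _ ⟩
    at u (source s r)                            ≡⟨ cong (at u) sr≡q ⟩
    at u q                                       ∎)
    where
    open ≡-Reasoning
    r : ℕ
    r = source (inverse s) q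
    sr≡q : source s r ≡ q
    sr≡q = source-inverseʳ s vs q

step-entry : ∀ (u v : Word) s S p {q x} → source s p ≡ q → at u q ≡ x → at v p ≡ signAt S p x →
             at v p ≡ signAt S p (at u (source s p))
step-entry u v s S p sp≡q uq≡x vp = trans vp (cong (signAt S p) (sym (trans (cong (at u) sp≡q) uq≡x)))

flips : Bool → List ℕ → List ℕ
flips false S = []
flips true S = S

signAt-flips-∈ : ∀ c S {p} x → p ∈ S → signAt (flips c S) p x ≡ sign c x
signAt-flips-∈ false S x _ = refl
signAt-flips-∈ true S x p∈S = if-cong (memℕ-true p∈S)

signAt-flips-∉ : ∀ c S {p} x → All (p ≢_) S → signAt (flips c S) p x ≡ x
signAt-flips-∉ false S x _ = refl
signAt-flips-∉ true S x p∉S = if-cong (memℕ-false p∉S)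

length-flips : ∀ c S → length S ≤ 2 → length (flips c S) ≤ 2
length-flips false S _ = z≤n
length-flips true S ≤2 = ≤2

All-flips : ∀ {P : ℕ → Set} c {S} → All P S → All P (flips c S)
All-flips false _ = []
All-flips true all = all

-- Embeddings of involutions

-- embed b u agrees with u, relabelled along φ and ψ, on the image of φ, and carries the
-- transposition of o₁ and o₂ (signed when b holds) on the remaining positions.
-- For L · k and L · k̄ there is a single new position, o₁ ≡ o₂.
record Embedding (m n : ℕ) : Set where
  field
    embed : Bool → Word → Word
    φ : ℕ → ℕ
    ψ ψ⁻¹ : ℤ → ℤ
    o₁ o₂ : ℕ
    φ-injective : ∀ {a b} → φ a ≡ φ b → a ≡ b
    φ-< : ∀ {q} → q < m → φ q < n
    o₁-< : o₁ < n
    o₂-< : o₂ < n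
    φ≢o₁ : ∀ {q} → q < m → φ q ≢ o₁
    φ≢o₂ : ∀ {q} → q < m → φ q ≢ o₂
    split : ∀ {p} → p < n → (Σ ℕ λ q → (q < m) × (φ q ≡ p)) ⊎ ((p ≡ o₁) ⊎ (p ≡ o₂))
    ψ-odd : ∀ x → ψ (- x) ≡ - ψ x
    ψ-suc : ∀ r → ψ (+ suc r) ≡ + suc (φ r)
    ψ⁻¹-ψ : ∀ y → ψ⁻¹ (ψ y) ≡ y
    embed-length : ∀ b u → length (embed b u) ≡ n
    embed-φ : ∀ b {u} → IsInvolution m u → ∀ {q} → q < m → at (embed b u) (φ q) ≡ ψ (at u q)
    embed-o₁ : ∀ b {u} → IsInvolution m u → at (embed b u) o₁ ≡ sign b (+ suc o₂)
    embed-o₂ : ∀ b {u} → IsInvolution m u → at (embed b u) o₂ ≡ sign b (+ suc o₁)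

module EmbeddingProperties {m n : ℕ} (e : Embedding m n) (b : Bool) where
  open Embedding e

  ψ-neg : ∀ r → ψ -[1+ r ] ≡ -[1+ φ r ]
  ψ-neg r = trans (ψ-odd (+ suc r)) (cong -_ (ψ-suc r))

  ψ-injective : ∀ {x y} → ψ x ≡ ψ y → x ≡ y
  ψ-injective {x} {y} e = trans (sym (ψ⁻¹-ψ x)) (trans (cong ψ⁻¹ e) (ψ⁻¹-ψ y))

  involutiveAt-o : ∀ {u o o′} → o′ < n → at (embed b u) o ≡ sign b (+ suc o′) →
                   at (embed b u) o′ ≡ sign b (+ suc o) → InvolutiveAt n (embed b u) o
  involutiveAt-o {u} {o} {o′} o′<n uo uo′ = involutiveAt (embed b u) uo
    (subst (1 ≤_) (sym (∣sign∣ b _)) (s≤s z≤n)) (subst (_≤ n) (sym (∣sign∣ b _)) o′<n)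
    (trans (apply-sign b (embed b u) o′) (trans (cong (sign b) uo′) (sign-involutive b _)))

  embed-involution : ∀ {u} → IsInvolution m u → IsInvolution n (embed b u)
  embed-involution {u} iu@(_ , hu) = embed-length b u , involutive
    where
    involutive : ∀ p → p < n → InvolutiveAt n (embed b u) p
    involutive p p<n with split p<n
    ... | inj₂ (inj₁ refl) = involutiveAt-o o₂-< (embed-o₁ b {u} iu) (embed-o₂ b {u} iu)
    ... | inj₂ (inj₂ refl) = involutiveAt-o o₁-< (embed-o₂ b {u} iu) (embed-o₁ b {u} iu)
    ... | inj₁ (q , q<m , refl) with at u q in uq | hu q q<m
    ...   | + suc r | _ , r<m , uuq =
            involutiveAt (embed b u) (trans (embed-φ b {u} iu q<m) (trans (cong ψ uq) (ψ-suc r)))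
              (s≤s z≤n) (φ-< r<m) (trans (embed-φ b {u} iu r<m) (trans (cong ψ uuq) (ψ-suc q)))
    ...   | -[1+ r ] | _ , r<m , uuq =
            involutiveAt (embed b u) (trans (embed-φ b {u} iu q<m) (trans (cong ψ uq) (ψ-neg r)))
              (s≤s z≤n) (φ-< r<m)
              (trans (cong -_ (embed-φ b {u} iu r<m)) (trans (sym (ψ-odd (at u r))) (trans (cong ψ uuq) (ψ-suc q))))

  embed-injective : ∀ {u v} → IsInvolution m u → IsInvolution m v → embed b u ≡ embed b v → u ≡ v
  embed-injective {u} {v} iu iv e = word-ext u v (proj₁ iu) (proj₁ iv) λ q q<m →
    ψ-injective (trans (sym (embed-φ b {u} iu q<m)) (trans (cong (λ w → at w (φ q)) e) (embed-φ b {v} iv q<m)))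

  embed-id-other : ∀ {u} → IsInvolution m u → (∀ q → q < m → at u q ≡ + suc q) →
                   ∀ {p} → p < n → p ≢ o₁ → p ≢ o₂ → at (embed b u) p ≡ + suc p
  embed-id-other {u} iu u-id p<n p≢o₁ p≢o₂ with split p<n
  ... | inj₂ (inj₁ refl) = ⊥-elim (p≢o₁ refl)
  ... | inj₂ (inj₂ refl) = ⊥-elim (p≢o₂ refl)
  ... | inj₁ (q , q<m , refl) = trans (embed-φ b {u} iu q<m) (trans (cong ψ (u-id q q<m)) (ψ-suc q))

  mapShape : Shape → Shape
  mapShape none = none
  mapShape (swap a b) = swap (φ a) (φ b)
  mapShape (rot a b c) = rot (φ a) (φ b) (φ c)

  φ-≢ : ∀ {a b} → a ≢ b → φ a ≢ φ b
  φ-≢ a≢b = a≢b ∘ φ-injective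

  mapShape-valid : ∀ s → ValidShape m s → ValidShape n (mapShape s)
  mapShape-valid none v = tt
  mapShape-valid (swap a b) (a< , b< , a≢b) = φ-< a< , φ-< b< , φ-≢ a≢b
  mapShape-valid (rot a b c) (a< , b< , c< , a≢b , b≢c , a≢c) =
    φ-< a< , φ-< b< , φ-< c< , φ-≢ a≢b , φ-≢ b≢c , φ-≢ a≢c

  source-mapShape : ∀ s q → source (mapShape s) (φ q) ≡ φ (source s q)
  source-mapShape none q = refl
  source-mapShape (swap a b) q
    rewrite ≡ᵇ-cong-injective φ φ-injective q a | ≡ᵇ-cong-injective φ φ-injective q b
    with q ≡ᵇ a | q ≡ᵇ b
  ... | true | _ = refl
  ... | false | true = refl
  ... | false | false = refl
  source-mapShape (rot a b c) q
    rewrite ≡ᵇ-cong-injective φ φ-injective q a | ≡ᵇ-cong-injective φ φ-injective q b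
          | ≡ᵇ-cong-injective φ φ-injective q c
    with q ≡ᵇ a | q ≡ᵇ b | q ≡ᵇ c
  ... | true | _ | _ = refl
  ... | false | true | _ = refl
  ... | false | false | true = refl
  ... | false | false | false = refl

  OutsideImage : ℕ → Set
  OutsideImage o = ∀ {q} → q < m → φ q ≢ o

  source-mapShape-outside : ∀ {o} → OutsideImage o → ∀ s → ValidShape m s → source (mapShape s) o ≡ o
  source-mapShape-outside out none v = refl
  source-mapShape-outside out (swap a b) (a< , b< , _) = source-swap-other (≢-sym (out a<)) (≢-sym (out b<))
  source-mapShape-outside out (rot a b c) (a< , b< , c< , _) =
    source-rot-other (≢-sym (out a<)) (≢-sym (out b<)) (≢-sym (out c<))

  memℕ-outside : ∀ {o} → OutsideImage o → ∀ {S} → All (_< m) S → memℕ o (map φ S) ≡ false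
  memℕ-outside out S<m = memℕ-false (All-map⁺ (All-map (≢-sym ∘ out) S<m))

  signAt-ψ : ∀ S q x → signAt (map φ S) (φ q) (ψ x) ≡ ψ (signAt S q x)
  signAt-ψ S q x rewrite memℕ-map φ φ-injective q S with memℕ q S
  ... | true = sym (ψ-odd x)
  ... | false = refl

  embed-step : ∀ {u v} → IsInvolution m u → IsInvolution m v → Step m u v → Step n (embed b u) (embed b v)
  embed-step {u} {v} iu iv (_ , _ , s , vs , S , lS , S<m , moves , pt) =
    embed-length b u , embed-length b v , mapShape s , mapShape-valid s vs , map φ S , length-map-≤ φ S lS ,
    All-map⁺ (All-map φ-< S<m) , (λ e eS → moves (mapShape-none s e) (map≡[] φ eS)) , pt′
    where
    mapShape-none : ∀ s → mapShape s ≡ none → s ≡ none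
    mapShape-none none _ = refl
    fixed-outside : ∀ {o} → OutsideImage o → at (embed b u) o ≡ at (embed b v) o →
                    at (embed b v) o ≡ signAt (map φ S) o (at (embed b u) (source (mapShape s) o))
    fixed-outside out uo≡vo rewrite source-mapShape-outside out s vs | memℕ-outside out S<m = sym uo≡vo
    pt′ : ∀ p → p < n → at (embed b v) p ≡ signAt (map φ S) p (at (embed b u) (source (mapShape s) p))
    pt′ p p<n with split p<n
    ... | inj₂ (inj₁ refl) = fixed-outside φ≢o₁ (trans (embed-o₁ b {u} iu) (sym (embed-o₁ b {v} iv)))
    ... | inj₂ (inj₂ refl) = fixed-outside φ≢o₂ (trans (embed-o₂ b {u} iu) (sym (embed-o₂ b {v} iv)))
    ... | inj₁ (q , q<m , refl) = begin
      at (embed b v) (φ q)                                        ≡⟨ embed-φ b {v} iv q<m ⟩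
      ψ (at v q)                                                ≡⟨ cong ψ (pt q q<m) ⟩
      ψ (signAt S q (at u (source s q)))                        ≡⟨ signAt-ψ S q _ ⟨
      signAt (map φ S) (φ q) (ψ (at u (source s q)))
        ≡⟨ cong (signAt (map φ S) (φ q)) (sym (embed-φ b {u} iu (source-< s vs q<m))) ⟩
      signAt (map φ S) (φ q) (at (embed b u) (φ (source s q)))
        ≡⟨ cong (λ t → signAt (map φ S) (φ q) (at (embed b u) t)) (source-mapShape s q) ⟨
      signAt (map φ S) (φ q) (at (embed b u) (source (mapShape s) (φ q))) ∎
      where open ≡-Reasoning

  ∣sign∣≢suc : ∀ {a o} → a ≢ o → ∣ sign b (+ suc o) ∣ ≢ suc a
  ∣sign∣≢suc a≢o e = a≢o (suc-injective (trans (sym e) (∣sign∣ b _)))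

  -- The preimage of v reads v through φ and ψ; an entry at a position φ q cannot point to o₁ or o₂,
  -- because those positions already point to each other.
  module Preimage {v : Word} (iv : IsInvolution n v)
    (v-o₁ : at v o₁ ≡ sign b (+ suc o₂)) (v-o₂ : at v o₂ ≡ sign b (+ suc o₁)) where

    w : Word
    w = oneLine m (λ x → ψ⁻¹ (apply v (ψ x)))

    at-w : ∀ {q} → q < m → at w q ≡ ψ⁻¹ (at v (φ q))
    at-w {q} q<m = trans (at-oneLine m (λ x → ψ⁻¹ (apply v (ψ x))) q<m) (cong (λ t → ψ⁻¹ (apply v t)) (ψ-suc q))

    w-at : ∀ {q y} → q < m → at v (φ q) ≡ ψ y → at w q ≡ y
    w-at {y = y} q<m vφq = trans (at-w q<m) (trans (cong ψ⁻¹ vφq) (ψ⁻¹-ψ y))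

    v-φ : ∀ {q} → q < m → Σ ℤ λ y → (1 ≤ ∣ y ∣) × (∣ y ∣ ≤ m) × (at v (φ q) ≡ ψ y)
    v-φ {q} q<m with at v (φ q) in vφq | proj₂ iv (φ q) (φ-< q<m)
    ... | + suc t | _ , t<n , vvφq with split t<n
    ...   | inj₁ (r , r<m , refl) = + suc r , s≤s z≤n , r<m , sym (ψ-suc r)
    ...   | inj₂ (inj₁ refl) = ⊥-elim (∣sign∣≢suc (φ≢o₂ q<m) (cong ∣_∣ (trans (sym v-o₁) vvφq)))
    ...   | inj₂ (inj₂ refl) = ⊥-elim (∣sign∣≢suc (φ≢o₁ q<m) (cong ∣_∣ (trans (sym v-o₂) vvφq)))
    v-φ {q} q<m | -[1+ t ] | _ , t<n , vvφq with split t<n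
    ...   | inj₁ (r , r<m , refl) = -[1+ r ] , s≤s z≤n , r<m , sym (ψ-neg r)
    ...   | inj₂ (inj₁ refl) = ⊥-elim (∣sign∣≢suc (φ≢o₂ q<m)
            (trans (sym (∣-i∣≡∣i∣ (sign b (+ suc o₂)))) (cong ∣_∣ (trans (cong -_ (sym v-o₁)) vvφq))))
    ...   | inj₂ (inj₂ refl) = ⊥-elim (∣sign∣≢suc (φ≢o₁ q<m)
            (trans (sym (∣-i∣≡∣i∣ (sign b (+ suc o₁)))) (cong ∣_∣ (trans (cong -_ (sym v-o₂)) vvφq))))

    w-involution : IsInvolution m w
    w-involution = length-oneLine m (λ x → ψ⁻¹ (apply v (ψ x))) , involutive
      where
      involutive : ∀ q → q < m → InvolutiveAt m w q
      involutive q q<m with v-φ q<m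
      ... | y , 1≤y , y≤m , vφq = involutiveAt w (w-at q<m vφq) 1≤y y≤m (back y 1≤y y≤m vφq)
        where
        vvφq : apply v (at v (φ q)) ≡ + suc (φ q)
        vvφq = proj₂ (proj₂ (proj₂ iv (φ q) (φ-< q<m)))
        back : ∀ y → 1 ≤ ∣ y ∣ → ∣ y ∣ ≤ m → at v (φ q) ≡ ψ y → apply w y ≡ + suc q
        back (+ suc r) _ r<m vφq′ = w-at r<m vφr
          where
          vφr : at v (φ r) ≡ ψ (+ suc q)
          vφr = trans (cong (apply v) (sym (trans vφq′ (ψ-suc r)))) (trans vvφq (sym (ψ-suc q)))
        back -[1+ r ] _ r<m vφq′ = cong -_ (w-at r<m vφr)
          where
          -vφr : - at v (φ r) ≡ + suc (φ q)
          -vφr = trans (cong (apply v) (sym (trans vφq′ (ψ-neg r)))) vvφq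
          vφr : at v (φ r) ≡ ψ -[1+ q ]
          vφr = trans (sym (neg-involutive (at v (φ r)))) (trans (cong -_ -vφr) (sym (ψ-neg q)))

    embed-w : embed b w ≡ v
    embed-w = word-ext (embed b w) v (embed-length b w) (proj₁ iv) agree
      where
      agree : ∀ p → p < n → at (embed b w) p ≡ at v p
      agree p p<n with split p<n
      ... | inj₂ (inj₁ refl) = trans (embed-o₁ b {w} w-involution) (sym v-o₁)
      ... | inj₂ (inj₂ refl) = trans (embed-o₂ b {w} w-involution) (sym v-o₂)
      ... | inj₁ (q , q<m , refl) with v-φ q<m
      ... | y , _ , _ , vφq = trans (embed-φ b {w} w-involution q<m) (trans (cong ψ (w-at q<m vφq)) (sym vφq))

  embed-surjective : ∀ {v} → IsInvolution n v →
                     at v o₁ ≡ sign b (+ suc o₂) → at v o₂ ≡ sign b (+ suc o₁) →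
                     Σ Word λ w → IsInvolution m w × (embed b w ≡ v)
  embed-surjective {v} iv v-o₁ v-o₂ = w , w-involution , embed-w
    where open Preimage {v} iv v-o₁ v-o₂

module Doubled {m n : ℕ} (e : Embedding m n) (b : Bool)
  (L : List Word) (exL : ExactlyOnce m L) (a2L : A2 m L) {x : Word} (hdL : head L ≡ just x) where

  open Embedding e

  list : List Word
  list = map (embed b) L ++ map (embed (not b)) (reverse L)

  flip-step : ∀ {z} → IsInvolution m z → Step n (embed b z) (embed (not b) z)
  -- When o₁ ≡ o₂ the new position is listed twice, which signAt ignores.
  flip-step {z} iz =
    embed-length b z , embed-length (not b) z , none , tt , o₁ ∷ o₂ ∷ [] , s≤s (s≤s z≤n) ,
    o₁-< ∷ o₂-< ∷ [] , (λ _ ()) , pt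
    where
    flipped : ∀ {o o′} → at (embed b z) o ≡ sign b (+ suc o′) → at (embed (not b) z) o ≡ sign (not b) (+ suc o′) →
              o ∈ o₁ ∷ o₂ ∷ [] → at (embed (not b) z) o ≡ signAt (o₁ ∷ o₂ ∷ []) o (at (embed b z) o)
    flipped bz nbz o∈ = trans nbz (trans (sign-not b _) (trans (cong -_ (sym bz)) (sym (if-cong (memℕ-true o∈)))))
    pt : ∀ p → p < n → at (embed (not b) z) p ≡ signAt (o₁ ∷ o₂ ∷ []) p (at (embed b z) p)
    pt p p<n with split p<n
    ... | inj₂ (inj₁ refl) = flipped (embed-o₁ b iz) (embed-o₁ (not b) iz) (here refl)
    ... | inj₂ (inj₂ refl) = flipped (embed-o₂ b iz) (embed-o₂ (not b) iz) (there (here refl))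
    ... | inj₁ (q , q<m , refl) = trans (embed-φ (not b) iz q<m) (trans (sym (embed-φ b iz q<m))
        (sym (if-cong (memℕ-false (φ≢o₁ q<m ∷ φ≢o₂ q<m ∷ [])))))

  allL : All (IsInvolution m) L
  allL = proj₁ exL

  involutions : All (IsInvolution n) list
  involutions = ++⁺ (All-map⁺ (All-map (EmbeddingProperties.embed-involution e b) allL))
                    (All-map⁺ (All-map (EmbeddingProperties.embed-involution e (not b)) (All-reverse allL)))

  at-o₂ : ∀ c {K} → All (IsInvolution m) K → All (λ w → at w o₂ ≡ sign c (+ suc o₁)) (map (embed c) K)
  at-o₂ c allK = All-map⁺ (All-map (embed-o₂ c) allK)

  ∣at-o₂∣ : All (λ w → ∣ at w o₂ ∣ ≡ suc o₁) list
  ∣at-o₂∣ = ++⁺ (All-map (λ e → trans (cong ∣_∣ e) (∣sign∣ b _)) (at-o₂ b allL))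
                (All-map (λ e → trans (cong ∣_∣ e) (∣sign∣ (not b) _)) (at-o₂ (not b) (All-reverse allL)))

  unique : Unique list
  unique = Unique.++⁺ (Unique-map (embed b) (EmbeddingProperties.embed-injective e b) allL (proj₁ (proj₂ exL)))
    (Unique-map (embed (not b)) (EmbeddingProperties.embed-injective e (not b)) (All-reverse allL)
                (Unique-reverse (proj₁ (proj₂ exL))))
    (λ (w∈ , w∈′) → sign-not-≢ b o₁ (trans (sym (All-lookup (at-o₂ b allL) w∈))
                                          (All-lookup (at-o₂ (not b) (All-reverse allL)) w∈′)))

  head-list : head list ≡ just (embed b x)
  head-list = head-++ {xs = map (embed b) L} (head-map-just (embed b) hdL)

  last-list : last list ≡ just (embed (not b) x)
  last-list = last-++ {xs = map (embed b) L} (last-map-just (embed (not b)) {reverse L} (trans (last-reverse L) hdL))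

  linked : Linked (Step n) list
  linked with last-exists {xs = L} hdL
  ... | z , ltL , z∈L = linked-++ {xs = map (embed b) L}
    (last-map-just (embed b) {L} ltL) (head-map-just (embed (not b)) {reverse L} (trans (head-reverse L) ltL))
    (flip-step (All-lookup allL z∈L))
    (linked-map (embed b) (λ {u} {v} → EmbeddingProperties.embed-step e b {u} {v}) allL a2L)
    (linked-map (embed (not b)) (λ {u} {v} → EmbeddingProperties.embed-step e (not b) {u} {v}) (All-reverse allL)
                (linked-reverse (λ {u} {v} → Step-sym {n = m} {u} {v}) a2L))

  complete : ∀ c {v} → IsInvolution n v → at v o₁ ≡ sign c (+ suc o₂) → at v o₂ ≡ sign c (+ suc o₁) → v ∈ list
  complete c {v} iv v-o₁ v-o₂ with EmbeddingProperties.embed-surjective e c {v} iv v-o₁ v-o₂ | c ≟𝔹 b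
  ... | w , iw , refl | yes refl = ∈-++⁺ˡ (∈-map⁺ (embed b) (proj₂ (proj₂ exL) w iw))
  ... | w , iw , refl | no c≢b rewrite ¬-not c≢b =
    ∈-++⁺ʳ (map (embed b) L) (∈-map⁺ (embed (not b)) (Any.reverse⁺ (proj₂ (proj₂ exL) w iw)))

-- The embeddings w ↦ w · k, w · k̄, w^{F_i} · (i n), w^{F_i} · (ī n̄)

lastSign : Bool → ℕ → ℤ → ℤ
lastSign false n = id
lastSign true n = neg n

lastSign-other : ∀ b {n x} → ∣ x ∣ ≢ n → lastSign b n x ≡ x
lastSign-other false _ = refl
lastSign-other true x≢n = if-cong (≡ᵇ-false x≢n)

lastSign-self : ∀ b n → lastSign b n (+ n) ≡ sign b (+ n)
lastSign-self false n = refl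
lastSign-self true n = if-cong (≡ᵇ-refl n)

module ExtendLast (M : ℕ) where

  extend : Bool → Word → Word
  extend b u = oneLine (suc M) (lastSign b (suc M) ∘ fixing (suc M ∷ []) (apply u))

  split : ∀ {p} → p < suc M → (Σ ℕ λ q → (q < M) × (q ≡ p)) ⊎ ((p ≡ M) ⊎ (p ≡ M))
  split {p} p<1+M with <-cmp p M
  ... | tri< p<M _ _ = inj₁ (p , p<M , refl)
  ... | tri≈ _ p≡M _ = inj₂ (inj₁ p≡M)
  ... | tri> _ _ p>M = ⊥-elim (<⇒≱ p<1+M p>M)

  extend-< : ∀ b {u} → IsInvolution M u → ∀ {q} → q < M → at (extend b u) q ≡ at u q
  extend-< b {u} iu {q} q<M =
    trans (at-oneLine (suc M) (lastSign b (suc M) ∘ fixing (suc M ∷ []) (apply u)) (m<n⇒m<1+n q<M))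
    (trans (cong (lastSign b (suc M)) (if-cong (≡ᵇ-false (<⇒≢ q<M))))
           (lastSign-other b (<⇒≢ (s≤s (proj₁ (proj₂ (proj₂ iu q q<M)))))))

  extend-last : ∀ b {u} → IsInvolution M u → at (extend b u) M ≡ sign b (+ suc M)
  extend-last b {u} _ =
    trans (at-oneLine (suc M) (lastSign b (suc M) ∘ fixing (suc M ∷ []) (apply u)) (n<1+n M))
    (trans (cong (lastSign b (suc M)) (if-cong (≡ᵇ-refl M))) (lastSign-self b (suc M)))

  embedding : Embedding M (suc M)
  embedding = record
    { embed = extend ; φ = id ; ψ = id ; ψ⁻¹ = id ; o₁ = M ; o₂ = M
    ; φ-injective = id ; φ-< = m<n⇒m<1+n ; o₁-< = n<1+n M ; o₂-< = n<1+n M ; φ≢o₁ = <⇒≢ ; φ≢o₂ = <⇒≢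
    ; split = split ; ψ-odd = λ _ → refl ; ψ-suc = λ _ → refl ; ψ⁻¹-ψ = λ _ → refl
    ; embed-length = λ b u → length-oneLine (suc M) (lastSign b (suc M) ∘ fixing (suc M ∷ []) (apply u))
    ; embed-φ = extend-< ; embed-o₁ = extend-last ; embed-o₂ = extend-last }

extendLast : ∀ M → Embedding M (suc M)
extendLast = ExtendLast.embedding

Fn-< : ∀ {i q} → q < i → Fn i q ≡ q
Fn-< q<i = if-cong (<ᵇ-true q<i)

Fn-≥ : ∀ {i q} → i ≤ q → Fn i q ≡ suc q
Fn-≥ i≤q = if-cong (<ᵇ-false i≤q)

Finvn-< : ∀ {i q} → q < i → Finvn i q ≡ q
Finvn-< q<i = if-cong (<ᵇ-true q<i)

Finvn-≥ : ∀ {i q} → i ≤ q → Finvn i q ≡ q ∸ 1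
Finvn-≥ i≤q = if-cong (<ᵇ-false i≤q)

Fn-suc : ∀ i q → Fn (suc i) (suc q) ≡ suc (Fn i q)
Fn-suc i q with <-cmp q i
... | tri< q<i _ _ = trans (Fn-< (s≤s q<i)) (cong suc (sym (Fn-< q<i)))
... | tri≈ _ refl _ = trans (Fn-≥ ≤-refl) (cong suc (sym (Fn-≥ ≤-refl)))
... | tri> _ _ q>i = trans (Fn-≥ (s≤s (<⇒≤ q>i))) (cong suc (sym (Fn-≥ (<⇒≤ q>i))))

Fn-≤ : ∀ i q → Fn i q ≤ suc q
Fn-≤ i q with <-cmp q i
... | tri< q<i _ _ = subst (_≤ suc q) (sym (Fn-< q<i)) (n≤1+n q)
... | tri≈ _ refl _ = subst (_≤ suc q) (sym (Fn-≥ ≤-refl)) ≤-refl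
... | tri> _ _ q>i = subst (_≤ suc q) (sym (Fn-≥ (<⇒≤ q>i))) ≤-refl

Fn-≢ : ∀ i q → Fn i q ≢ i
Fn-≢ i q with <-cmp q i
... | tri< q<i _ _ = subst (_≢ i) (sym (Fn-< q<i)) (<⇒≢ q<i)
... | tri≈ _ refl _ = subst (_≢ i) (sym (Fn-≥ ≤-refl)) (≢-sym (<⇒≢ (n<1+n i)))
... | tri> _ _ q>i = subst (_≢ i) (sym (Fn-≥ (<⇒≤ q>i))) (≢-sym (<⇒≢ (m<n⇒m<1+n q>i)))

Finvn-Fn : ∀ i q → Finvn i (Fn i q) ≡ q
Finvn-Fn i q with <-cmp q i
... | tri< q<i _ _ = trans (cong (Finvn i) (Fn-< q<i)) (Finvn-< q<i)
... | tri≈ _ refl _ = trans (cong (Finvn i) (Fn-≥ ≤-refl)) (Finvn-≥ (n≤1+n i))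
... | tri> _ _ q>i = trans (cong (Finvn i) (Fn-≥ (<⇒≤ q>i))) (Finvn-≥ (m≤n⇒m≤1+n (<⇒≤ q>i)))

Fn-injective : ∀ i {a b} → Fn i a ≡ Fn i b → a ≡ b
Fn-injective i {a} {b} e = trans (sym (Finvn-Fn i a)) (trans (cong (Finvn i) e) (Finvn-Fn i b))

∣oddExt∣ : ∀ f y → ∣ oddExt f y ∣ ≡ f ∣ y ∣
∣oddExt∣ f (+ k) = refl
∣oddExt∣ f -[1+ k ] = ∣-i∣≡∣i∣ (+ f (suc k))

transposition : Bool → ℕ → ℕ → ℤ → ℤ
transposition false = tr
transposition true = trBar

≢+ : ∀ {x i} → ∣ x ∣ ≢ i → x ≢ + i
≢+ x≢i refl = x≢i refl

≢-+ : ∀ {x i} → ∣ x ∣ ≢ i → x ≢ - (+ i)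
≢-+ {x} {i} x≢i e = x≢i (trans (cong ∣_∣ e) (∣-i∣≡∣i∣ (+ i)))

+≢-+ : ∀ {i j} → i ≢ j → + j ≢ - (+ i)
+≢-+ {zero} i≢j e = i≢j (sym (cong ∣_∣ e))
+≢-+ {suc i} i≢j ()

transpositionByTests : Bool → ℕ → ℕ → ℤ → ℤ
transpositionByTests b i j x =
  if x ==ℤ (+ i) then sign b (+ j) else if x ==ℤ (- (+ i)) then sign (not b) (+ j) else
  if x ==ℤ (+ j) then sign b (+ i) else if x ==ℤ (- (+ j)) then sign (not b) (+ i) else x

transposition-byTests : ∀ b i j x → transposition b i j x ≡ transpositionByTests b i j x
transposition-byTests false i j x = refl
transposition-byTests true i j x = refl

transposition-other : ∀ b {i j x} → ∣ x ∣ ≢ i → ∣ x ∣ ≢ j → transposition b i j x ≡ x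
transposition-other b {i} {j} {x} x≢i x≢j = trans (transposition-byTests b i j x)
  (trans (if-cong (==ℤ-false {x} (≢+ x≢i))) (trans (if-cong (==ℤ-false {x} (≢-+ x≢i)))
  (trans (if-cong (==ℤ-false {x} (≢+ x≢j))) (if-cong (==ℤ-false {x} (≢-+ x≢j))))))

transposition-fst : ∀ b i j → transposition b i j (+ i) ≡ sign b (+ j)
transposition-fst b i j = trans (transposition-byTests b i j (+ i)) (if-cong (==ℤ-refl (+ i)))

transposition-snd : ∀ b {i j} → i ≢ j → transposition b i j (+ j) ≡ sign b (+ i)
transposition-snd b {i} {j} i≢j = trans (transposition-byTests b i j (+ j))
  (trans (if-cong (==ℤ-false {+ j} {+ i} (i≢j ∘ sym ∘ cong ∣_∣))) (trans (if-cong (==ℤ-false (+≢-+ i≢j)))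
  (if-cong (==ℤ-refl (+ j)))))

module ExtendTransposition (m i′ : ℕ) (i′≤m : i′ ≤ m) where

  i n : ℕ
  i = suc i′
  n = suc (suc m)

  extend : Bool → Word → Word
  extend b u = oneLine n (transposition b i n ∘ fixing (i ∷ n ∷ []) (conj i u))

  ψ : ℤ → ℤ
  ψ = oddExt (Fn i)

  φ-< : ∀ {q} → q < m → Fn i′ q < n
  φ-< {q} q<m = s≤s (≤-trans (Fn-≤ i′ q) (m≤n⇒m≤1+n q<m))

  φ≢last : ∀ {q} → q < m → Fn i′ q ≢ suc m
  φ≢last {q} q<m = <⇒≢ (s≤s (≤-trans (Fn-≤ i′ q) q<m))

  ψ-odd : ∀ x → ψ (- x) ≡ - ψ x
  ψ-odd (+ zero) = refl
  ψ-odd (+ suc k) = refl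
  ψ-odd -[1+ k ] = sym (neg-involutive _)

  ψ⁻¹-ψ : ∀ y → oddExt (Finvn i) (ψ y) ≡ y
  ψ⁻¹-ψ (+ k) = cong +_ (Finvn-Fn i k)
  ψ⁻¹-ψ -[1+ k ] = trans (cong (λ t → oddExt (Finvn i) (- (+ t))) (Fn-suc i′ k))
    (cong (λ t → - (+ t)) (trans (cong (Finvn i) (sym (Fn-suc i′ k))) (Finvn-Fn i (suc k))))

  split : ∀ {p} → p < n → (Σ ℕ λ q → (q < m) × (Fn i′ q ≡ p)) ⊎ ((p ≡ i′) ⊎ (p ≡ suc m))
  split {p} p<n with <-cmp p i′
  ... | tri< p<i′ _ _ = inj₁ (p , <-≤-trans p<i′ i′≤m , Fn-< p<i′)
  ... | tri≈ _ p≡i′ _ = inj₂ (inj₁ p≡i′)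
  split {suc p} (s≤s (s≤s p≤m)) | tri> _ _ (s≤s i′≤p) with p ≟ m
  ... | yes refl = inj₂ (inj₂ refl)
  ... | no p≢m = inj₁ (p , ≤∧≢⇒< p≤m p≢m , Fn-≥ i′≤p)

  i≢n : i ≢ n
  i≢n = <⇒≢ (s≤s (s≤s i′≤m))

  extend-φ : ∀ b {u} → IsInvolution m u → ∀ {q} → q < m → at (extend b u) (Fn i′ q) ≡ ψ (at u q)
  extend-φ b {u} iu {q} q<m = begin
    at (extend b u) (Fn i′ q)
      ≡⟨ at-oneLine n (transposition b i n ∘ fixing (i ∷ n ∷ []) (conj i u)) (φ-< q<m) ⟩
    transposition b i n (fixing (i ∷ n ∷ []) (conj i u) (+ suc (Fn i′ q)))
      ≡⟨ cong (λ t → transposition b i n (fixing (i ∷ n ∷ []) (conj i u) (+ t))) (Fn-suc i′ q) ⟨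
    transposition b i n (fixing (i ∷ n ∷ []) (conj i u) (+ Fn i (suc q)))
      ≡⟨ cong (transposition b i n) (trans (if-cong (≡ᵇ-false (Fn-≢ i (suc q)))) (if-cong (≡ᵇ-false Fnq≢n))) ⟩
    transposition b i n (ψ (apply u (+ Finvn i (Fn i (suc q)))))
      ≡⟨ cong (λ t → transposition b i n (ψ (apply u (+ t)))) (Finvn-Fn i (suc q)) ⟩
    transposition b i n (ψ (at u q))
      ≡⟨ transposition-other b (λ e → Fn-≢ i ∣ at u q ∣ (trans (sym (∣oddExt∣ (Fn i) (at u q))) e))
                               (λ e → <⇒≢ ∣ψuq∣<n (trans (sym (∣oddExt∣ (Fn i) (at u q))) e)) ⟩
    ψ (at u q)                                                     ∎
    where
    open ≡-Reasoning
    Fnq≢n : Fn i (suc q) ≢ n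
    Fnq≢n = <⇒≢ (≤-<-trans (Fn-≤ i (suc q)) (s≤s (s≤s q<m)))
    ∣ψuq∣<n : Fn i ∣ at u q ∣ < n
    ∣ψuq∣<n = ≤-<-trans (Fn-≤ i ∣ at u q ∣) (s≤s (s≤s (proj₁ (proj₂ (proj₂ iu q q<m)))))

  extend-i : ∀ b {u} → IsInvolution m u → at (extend b u) i′ ≡ sign b (+ n)
  extend-i b {u} _ = trans (at-oneLine n (transposition b i n ∘ fixing (i ∷ n ∷ []) (conj i u)) (s≤s (m≤n⇒m≤1+n i′≤m)))
    (trans (cong (transposition b i n) (if-cong (≡ᵇ-refl i))) (transposition-fst b i n))

  extend-n : ∀ b {u} → IsInvolution m u → at (extend b u) (suc m) ≡ sign b (+ i)
  extend-n b {u} _ = trans (at-oneLine n (transposition b i n ∘ fixing (i ∷ n ∷ []) (conj i u)) ≤-refl)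
    (trans (cong (transposition b i n) (trans (if-cong (≡ᵇ-false (≢-sym i≢n))) (if-cong (≡ᵇ-refl n))))
           (transposition-snd b i≢n))

  embedding : Embedding m n
  embedding = record
    { embed = extend ; φ = Fn i′ ; ψ = ψ ; ψ⁻¹ = oddExt (Finvn i) ; o₁ = i′ ; o₂ = suc m
    ; φ-injective = Fn-injective i′ ; φ-< = φ-< ; o₁-< = s≤s (m≤n⇒m≤1+n i′≤m) ; o₂-< = ≤-refl
    ; φ≢o₁ = λ {q} _ → Fn-≢ i′ q ; φ≢o₂ = φ≢last
    ; split = split ; ψ-odd = ψ-odd ; ψ-suc = λ r → cong +_ (Fn-suc i′ r) ; ψ⁻¹-ψ = ψ⁻¹-ψ
    ; embed-length = λ b u → length-oneLine n (transposition b i n ∘ fixing (i ∷ n ∷ []) (conj i u))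
    ; embed-φ = extend-φ ; embed-o₁ = extend-i ; embed-o₂ = extend-n }

extendTransposition : ∀ m i′ → i′ ≤ m → Embedding m (suc (suc m))
extendTransposition = ExtendTransposition.embedding

-- Assembling GCB(n)

module NextGCB (m : ℕ) (A B : List Word)
  (hA : ExactlyOnce (suc m) A × A1 (suc m) A × A2 (suc m) A)
  (hB : ExactlyOnce m B × A1 m B × A2 m B) where

  n : ℕ
  n = suc (suc m)

  idA idB : Word
  idA = cyc (suc m) []
  idB = cyc m []

  exA : ExactlyOnce (suc m) A
  exA = proj₁ hA
  hdA : head A ≡ just idA
  hdA = proj₁ (proj₁ (proj₂ hA))
  exB : ExactlyOnce m B
  exB = proj₁ hB
  hdB : head B ≡ just idB
  hdB = proj₁ (proj₁ (proj₂ hB))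

  idA-involution : IsInvolution (suc m) idA
  idA-involution = All-lookup (proj₁ exA) (head∈ hdA)
  idB-involution : IsInvolution m idB
  idB-involution = All-lookup (proj₁ exB) (head∈ hdB)

  eLast : Embedding (suc m) n
  eLast = extendLast (suc m)

  eTransposition : ∀ j → j ≤ m → Embedding m n
  eTransposition = extendTransposition m

  extended : Bool → Word
  extended c = Embedding.embed eLast c idA

  -- Positions are 0-based: block suc j carries its new entries at positions j and suc m.
  transposed : Bool → ∀ j → j ≤ m → Word
  transposed c j j≤m = Embedding.embed (eTransposition j j≤m) c idB

  module First = Doubled eLast false A exA (proj₂ (proj₂ hA)) hdA
  module Block (j : ℕ) (j≤m : j ≤ m) = Doubled (eTransposition j j≤m) (odd (suc j)) B exB (proj₂ (proj₂ hB)) hdB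

  block≡ : ∀ j (j≤m : j ≤ m) → block n B (suc j) ≡ Block.list j j≤m
  block≡ j j≤m = if-branches
    (λ c → map (Embedding.embed (eTransposition j j≤m) c) B ++
           map (Embedding.embed (eTransposition j j≤m) (not c)) (reverse B))
    (odd (suc j))

  extended-last : ∀ c → at (extended c) (suc m) ≡ sign c (+ n)
  extended-last c = Embedding.embed-o₁ eLast c idA-involution

  extended-other : ∀ c {p} → p < suc m → at (extended c) p ≡ + suc p
  extended-other c p<1+m = EmbeddingProperties.embed-id-other eLast c idA-involution (λ _ → at-id (suc m))
    (m<n⇒m<1+n p<1+m) (<⇒≢ p<1+m) (<⇒≢ p<1+m)

  transposed-fst : ∀ c j j≤m → at (transposed c j j≤m) j ≡ sign c (+ n)
  transposed-fst c j j≤m = Embedding.embed-o₁ (eTransposition j j≤m) c idB-involution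

  transposed-snd : ∀ c j j≤m → at (transposed c j j≤m) (suc m) ≡ sign c (+ suc j)
  transposed-snd c j j≤m = Embedding.embed-o₂ (eTransposition j j≤m) c idB-involution

  transposed-other : ∀ c j j≤m {p} → p < n → p ≢ j → p ≢ suc m → at (transposed c j j≤m) p ≡ + suc p
  transposed-other c j j≤m = EmbeddingProperties.embed-id-other (eTransposition j j≤m) c idB-involution (λ _ → at-id m)

  rotation-step : ∀ c j (j<m : j < m) → Step n (transposed c j (<⇒≤ j<m)) (transposed c (suc j) j<m)
  rotation-step c j j<m =
    Embedding.embed-length (eTransposition j j≤m) c idB , Embedding.embed-length (eTransposition (suc j) j<m) c idB ,
    shape , (j<n , ≤-refl , s≤s (m≤n⇒m≤1+n j<m) , j≢1+m , ≢-sym 1+j≢1+m , j≢1+j) ,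
    flips c S , length-flips c S (s≤s (s≤s z≤n)) , All-flips c (j<n ∷ ≤-refl ∷ []) , (λ ()) , pt
    where
    j≤m : j ≤ m
    j≤m = <⇒≤ j<m
    j<n : j < n
    j<n = s≤s (m≤n⇒m≤1+n j≤m)
    j≢1+m : j ≢ suc m
    j≢1+m = <⇒≢ (s≤s j≤m)
    1+j≢1+m : suc j ≢ suc m
    1+j≢1+m = <⇒≢ (s≤s j<m)
    j≢1+j : j ≢ suc j
    j≢1+j = <⇒≢ (n<1+n j)
    S : List ℕ
    S = j ∷ suc m ∷ []
    u v : Word
    u = transposed c j j≤m
    v = transposed c (suc j) j<m
    shape : Shape
    shape = rot j (suc m) (suc j)
    pt : ∀ p → p < n → at v p ≡ signAt (flips c S) p (at u (source shape p))
    pt p p<n with p ≟ j | p ≟ suc m | p ≟ suc j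
    ... | yes refl | _ | _ = step-entry u v shape (flips c S) p (source-rot₁ p (suc m) (suc p)) (transposed-snd c p j≤m)
          (trans (transposed-other c (suc p) j<m p<n j≢1+j j≢1+m)
                 (sym (trans (signAt-flips-∈ c S _ (here refl)) (sign-involutive c _))))
    ... | no _ | yes refl | _ = step-entry u v shape (flips c S) (suc m) (source-rot₂ (≢-sym j≢1+m))
          (transposed-other c j j≤m (s≤s (s≤s j≤m)) (≢-sym j≢1+j) 1+j≢1+m)
          (trans (transposed-snd c (suc j) j<m) (sym (signAt-flips-∈ c S _ (there (here refl)))))
    ... | no _ | no p≢1+m | yes refl = step-entry u v shape (flips c S) (suc j)
          (source-rot₃ (≢-sym j≢1+j) 1+j≢1+m) (transposed-fst c j j≤m)
          (trans (transposed-fst c (suc j) j<m) (sym (signAt-flips-∉ c S _ (≢-sym j≢1+j ∷ p≢1+m ∷ []))))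
    ... | no p≢j | no p≢1+m | no p≢1+j = step-entry u v shape (flips c S) p (source-rot-other p≢j p≢1+m p≢1+j)
          (transposed-other c j j≤m p<n p≢j p≢1+m)
          (trans (transposed-other c (suc j) j<m p<n p≢1+j p≢1+m) (sym (signAt-flips-∉ c S _ (p≢j ∷ p≢1+m ∷ []))))

  entry-step : Step n (extended true) (transposed true 0 z≤n)
  entry-step =
    Embedding.embed-length eLast true idA , Embedding.embed-length (eTransposition 0 z≤n) true idB ,
    shape , (s≤s z≤n , ≤-refl , λ ()) , suc m ∷ [] , s≤s z≤n , ≤-refl ∷ [] , (λ ()) , pt
    where
    u v : Word
    u = extended true
    v = transposed true 0 z≤n
    shape : Shape
    shape = swap 0 (suc m)
    pt : ∀ p → p < n → at v p ≡ signAt (suc m ∷ []) p (at u (source shape p))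
    pt p p<n with p ≟ 0 | p ≟ suc m
    ... | yes refl | _ = step-entry u v shape (suc m ∷ []) 0 (source-swap₁ 0 (suc m)) (extended-last true)
          (trans (transposed-fst true 0 z≤n) (sym (signAt-flips-∉ true (suc m ∷ []) {0} _ ((λ ()) ∷ []))))
    ... | no _ | yes refl = step-entry u v shape (suc m ∷ []) (suc m)
          (source-swap₂ {0} {suc m} λ ()) (extended-other true (s≤s z≤n))
          (trans (transposed-snd true 0 z≤n) (sym (signAt-flips-∈ true (suc m ∷ []) _ (here refl))))
    ... | no p≢0 | no p≢1+m = step-entry u v shape (suc m ∷ []) p (source-swap-other p≢0 p≢1+m)
          (extended-other true (≤∧≢⇒< (≤-pred p<n) p≢1+m))
          (trans (transposed-other true 0 z≤n p<n p≢0 p≢1+m) (sym (signAt-flips-∉ true (suc m ∷ []) _ (p≢1+m ∷ []))))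

  closing-step : ∀ c → Step n (transposed c m ≤-refl) (extended false)
  closing-step c =
    Embedding.embed-length (eTransposition m ≤-refl) c idB , Embedding.embed-length eLast false idA ,
    shape , (m<n , ≤-refl , m≢1+m) , flips c S , length-flips c S (s≤s (s≤s z≤n)) ,
    All-flips c (m<n ∷ ≤-refl ∷ []) , (λ ()) , pt
    where
    m<n : m < n
    m<n = m<n⇒m<1+n (n<1+n m)
    m≢1+m : m ≢ suc m
    m≢1+m = <⇒≢ (n<1+n m)
    S : List ℕ
    S = m ∷ suc m ∷ []
    u v : Word
    u = transposed c m ≤-refl
    v = extended false
    shape : Shape
    shape = swap m (suc m)
    pt : ∀ p → p < n → at v p ≡ signAt (flips c S) p (at u (source shape p))
    pt p p<n with p ≟ m | p ≟ suc m
    ... | yes refl | _ = step-entry u v shape (flips c S) m (source-swap₁ p (suc p)) (transposed-snd c p ≤-refl)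
          (trans (extended-other false (n<1+n p)) (sym (trans (signAt-flips-∈ c S _ (here refl)) (sign-involutive c _))))
    ... | no _ | yes refl = step-entry u v shape (flips c S) (suc m) (source-swap₂ (≢-sym m≢1+m)) (transposed-fst c m ≤-refl)
          (trans (extended-last false) (sym (trans (signAt-flips-∈ c S _ (there (here refl))) (sign-involutive c _))))
    ... | no p≢m | no p≢1+m = step-entry u v shape (flips c S) p (source-swap-other p≢m p≢1+m)
          (transposed-other c m ≤-refl p<n p≢m p≢1+m)
          (trans (extended-other false (≤∧≢⇒< (≤-pred p<n) p≢1+m)) (sym (signAt-flips-∉ c S _ (p≢m ∷ p≢1+m ∷ []))))

  extended-identity : extended false ≡ cyc n []
  extended-identity = word-ext (extended false) (cyc n []) (Embedding.embed-length eLast false idA) (length-oneLine n id) entries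
    where
    entries : ∀ p → p < n → at (extended false) p ≡ at (cyc n []) p
    entries p p<n with p ≟ suc m
    ... | yes refl = trans (extended-last false) (sym (at-id n p<n))
    ... | no p≢1+m = trans (extended-other false (≤∧≢⇒< (≤-pred p<n) p≢1+m)) (sym (at-id n p<n))

  transposed-transposition : ∀ c → transposed c m ≤-refl ≡ cyc n (transposition c (suc m) n ∷ [])
  transposed-transposition c = word-ext _ _ (Embedding.embed-length (eTransposition m ≤-refl) c idB) (length-oneLine n g) entries
    where
    g : ℤ → ℤ
    g = transposition c (suc m) n ∘ id
    entries : ∀ p → p < n → at (transposed c m ≤-refl) p ≡ at (cyc n (transposition c (suc m) n ∷ [])) p
    entries p p<n with p ≟ m | p ≟ suc m
    ... | yes refl | _ = trans (transposed-fst c p ≤-refl) (sym (trans (at-oneLine n g p<n) (transposition-fst c (suc p) n)))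
    ... | no _ | yes refl = trans (transposed-snd c m ≤-refl)
          (sym (trans (at-oneLine n g p<n) (transposition-snd c (<⇒≢ (n<1+n (suc m))))))
    ... | no p≢m | no p≢1+m = trans (transposed-other c m ≤-refl p<n p≢m p≢1+m)
          (sym (trans (at-oneLine n g p<n) (transposition-other c (p≢m ∘ suc-injective) (p≢1+m ∘ suc-injective))))

  indices : List ℕ
  indices = applyUpTo suc (suc m)

  blocks list : List Word
  blocks = concatMap (block n B) indices
  list = First.list ++ blocks

  block-property : ∀ (P : List Word → Set) → (∀ j (j≤m : j ≤ m) → P (Block.list j j≤m)) →
                   ∀ {i} → i ∈ indices → P (block n B i)
  block-property P h i∈ with ∈-applyUpTo⁻ suc i∈
  ... | j , j<1+m , refl = subst P (sym (block≡ j (≤-pred j<1+m))) (h j (≤-pred j<1+m))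

  key : Word → ℕ
  key w = ∣ at w (suc m) ∣

  block-keys : ∀ {i} → i ∈ indices → All (λ w → key w ≡ i) (block n B i)
  block-keys {i} i∈ with ∈-applyUpTo⁻ suc i∈
  ... | j , j<1+m , refl =
    subst (All (λ w → key w ≡ suc j)) (sym (block≡ j (≤-pred j<1+m))) (Block.∣at-o₂∣ j (≤-pred j<1+m))

  open Keyed (block n B) key using (κ∈; Unique-concatMap)

  -- v(n) = ±(r+1) forces v(r+1) = ±n with the same sign, so v lies in the first pair when r + 1 = n
  -- and in the block of index r + 1 otherwise.
  complete : ∀ v → IsInvolution n v → v ∈ list
  complete v iv with proj₂ iv (suc m) ≤-refl
  ... | 1≤t , t≤n , vvt with signed-form (at v (suc m)) 1≤t
  ... | c , r , vt = at-r-case (r ≟ suc m)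
    where
    vr : at v r ≡ sign c (+ n)
    vr = trans (sym (sign-involutive c (at v r)))
      (cong (sign c) (trans (sym (apply-sign c v r)) (trans (cong (apply v) (sym vt)) vvt)))
    r≤1+m : r ≤ suc m
    r≤1+m = ≤-pred (subst (_≤ n) (trans (cong ∣_∣ vt) (∣sign∣ c _)) t≤n)
    at-r-case : Dec (r ≡ suc m) → v ∈ list
    at-r-case (yes refl) = ∈-++⁺ˡ (First.complete c iv vr vt)
    at-r-case (no r≢1+m) = ∈-++⁺ʳ First.list (∈-concatMap (block n B) (∈-applyUpTo⁺ suc (s≤s r≤m))
      (subst (v ∈_) (sym (block≡ r r≤m)) (Block.complete r r≤m c iv vr vt)))
      where
      r≤m : r ≤ m
      r≤m = ≤-pred (≤∧≢⇒< r≤1+m r≢1+m)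

  blocks-involutions : All (IsInvolution n) blocks
  blocks-involutions = All-concatMap (block n B) (block-property (All (IsInvolution n)) Block.involutions)

  blocks-unique : Unique blocks
  blocks-unique = Unique-concatMap (Unique.applyUpTo⁺₁ suc (suc m) (λ i<j _ → <⇒≢ (s≤s i<j)))
    (block-property Unique Block.unique) block-keys

  first-blocks-disjoint : ∀ {w} → w ∈ First.list → w ∈ blocks → ⊥
  first-blocks-disjoint w∈F w∈B with ∈-applyUpTo⁻ suc (All-lookup (κ∈ block-keys) w∈B)
  ... | j , j<1+m , key≡1+j = <⇒≢ (s≤s j<1+m) (sym (trans (sym (All-lookup First.∣at-o₂∣ w∈F)) key≡1+j))

  exactlyOnce : ExactlyOnce n list
  exactlyOnce = ++⁺ First.involutions blocks-involutions ,
                Unique.++⁺ First.unique blocks-unique (λ (w∈F , w∈B) → first-blocks-disjoint w∈F w∈B) ,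
                complete

  block-head : ∀ j (j≤m : j ≤ m) → head (block n B (suc j)) ≡ just (transposed (odd (suc j)) j j≤m)
  block-head j j≤m = trans (cong head (block≡ j j≤m)) (Block.head-list j j≤m)

  block-last : ∀ j (j≤m : j ≤ m) → last (block n B (suc j)) ≡ just (transposed (not (odd (suc j))) j j≤m)
  block-last j j≤m = trans (cong last (block≡ j j≤m)) (Block.last-list j j≤m)

  blocks-linked : Linked (Step n) blocks
  blocks-linked = linked-concatMap-applyUpTo (block n B) suc (suc m)
    (λ {j} j<1+m → subst (Linked (Step n)) (sym (block≡ j (≤-pred j<1+m))) (Block.linked j (≤-pred j<1+m)))
    junction
    where
    junction : ∀ {j} → suc j < suc m → Σ Word λ x → Σ Word λ y →
               (last (block n B (suc j)) ≡ just x) × (head (block n B (suc (suc j))) ≡ just y) × Step n x y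
    junction {j} (s≤s j<m) = _ , _ , block-last j (<⇒≤ j<m) , block-head (suc j) j<m ,
      subst (λ c → Step n (transposed c j (<⇒≤ j<m)) (transposed (odd j) (suc j) j<m)) (sym (not-odd-suc j))
            (rotation-step (odd j) j j<m)

  head-list : head list ≡ just (extended false)
  head-list = head-++ {xs = First.list} First.head-list

  last-list : last list ≡ just (transposed (not (odd (suc m))) m ≤-refl)
  last-list = last-++ {xs = First.list} (last-concatMap-applyUpTo (block n B) suc m (block-last m ≤-refl))

  a1 : A1 n list
  a1 = trans head-list (cong just extended-identity) , last-transposition (not (odd (suc m))) last-list
    where
    last-transposition : ∀ c → last list ≡ just (transposed c m ≤-refl) →
      (last list ≡ just (cyc n (tr (suc m) n ∷ []))) ⊎ (last list ≡ just (cyc n (trBar (suc m) n ∷ [])))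
    last-transposition false e = inj₁ (trans e (cong just (transposed-transposition false)))
    last-transposition true e = inj₂ (trans e (cong just (transposed-transposition true)))

  a2 : A2 n list
  a2 = linked-++ {xs = First.list} First.last-list
    (head-concatMap-applyUpTo (block n B) suc m (block-head 0 z≤n)) entry-step First.linked blocks-linked

  cyclic : Cyclic n list
  cyclic = _ , _ , head-list , last-list , closing-step (not (odd (suc m)))

theorem3p4 : (n : ℕ) → 4 ≤ n →
    (ExactlyOnce (n ∸ 2) (GCB (n ∸ 2)) × A1 (n ∸ 2) (GCB (n ∸ 2)) × A2 (n ∸ 2) (GCB (n ∸ 2))) →
    (ExactlyOnce (n ∸ 1) (GCB (n ∸ 1)) × A1 (n ∸ 1) (GCB (n ∸ 1)) × A2 (n ∸ 1) (GCB (n ∸ 1))) →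
    ExactlyOnce n (GCB n) × A1 n (GCB n) × A2 n (GCB n) × Cyclic n (GCB n)
theorem3p4 n@(suc (suc m@(suc (suc _)))) (s≤s (s≤s (s≤s (s≤s z≤n)))) hB hA =
  subst (λ L → ExactlyOnce n L × A1 n L × A2 n L × Cyclic n L) (sym GCB≡)
    (exactlyOnce , a1 , a2 , cyclic)
  where
  open NextGCB m (GCB (suc m)) (GCB m) hA hB hiding (n)
  GCB≡ : GCB n ≡ list
  GCB≡ = sym (++-assoc (map (dotFix n) (GCB (suc m))) (map (dotNeg n) (reverse (GCB (suc m)))) blocks)
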